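{- Let $q$ be a prime power, $0<k<n$ and $0\le t\le k$ integers, and let $C\in\mathcal{C}_t(n,k)$. The orbit of $C$ under the action of the monomial group $\mathcal{M}(V)$ is contained in a single connected component of the graph $\Delta_t(n,k)$.
   Context: Let $V=\mathbb{F}_q^n$ with standard basis $e_1,\dots,e_n$. An $[n,k]$-linear code is a $k$-dimensional subspace of $V$; $\mathcal{C}_t(n,k)$ denotes the set of $[n,k]$-codes such that any $t$ columns of a generator matrix (a $k\times n$ matrix whose rows form a basis) are linearly independent. $\Delta_t(n,k)$ is the graph with vertex set $\mathcal{C}_t(n,k)$ in which $X,Y$ are adjacent iff $\dim(X\cap Y)=k-1$. The monomial group $\mathcal{M}(V)$ is the group of linear transformations of $V$ mapping the set $\{\langle e_1\rangle,\dots,\langle e_n\rangle\}$ to itself (matrices that are a permutation matrix times an invertible diagonal matrix); it acts on subspaces of $V$. -}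

module Defs where

open import Level using (Level; _⊔_) renaming (suc to lsuc)
open import Data.Nat using (ℕ; zero; suc; _^_; _∸_; _≤_; _<_)
open import Data.Nat.Primality using (Prime)
open import Data.Fin using (Fin; zero; suc)
open import Data.Fin.Permutation using (Permutation′; _⟨$⟩ʳ_)
open import Data.Product using (Σ; ∃; ∃-syntax; _×_; _,_)
open import Function using (Injective)
open import Relation.Binary.PropositionalEquality using (_≡_)
open import Relation.Nullary using (¬_)
open import Relation.Binary.Construct.Closure.ReflexiveTransitive using (Star)
open import Algebra.Bundles using (CommutativeRing)

IsPrimePower : ℕ → Set
IsPrimePower q = ∃[ p ] ∃[ e ] (Prime p × q ≡ p ^ suc e)

record Field (c ℓ : Level) : Set (lsuc (c ⊔ ℓ)) where
  field
    commRing : CommutativeRing c ℓ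
  open CommutativeRing commRing public
  field
    0≉1     : ¬ (0# ≈ 1#)
    inverse : ∀ x → ¬ (x ≈ 0#) → ∃[ y ] (x * y ≈ 1#)

record HasOrder {c ℓ} (F : Field c ℓ) (q : ℕ) : Set (c ⊔ ℓ) where
  open Field F using (Carrier; _≈_; _+_; _*_; 0#; 1#)
  field
    enum       : Fin q → Carrier
    enum-inj   : ∀ i j → enum i ≈ enum j → i ≡ j
    enum-surj  : ∀ x → ∃[ i ] (enum i ≈ x)

module Codes {c ℓ} (F : Field c ℓ) where
  open Field F using (Carrier; _≈_; _+_; _*_; 0#; 1#)

  Vec : ℕ → Set c
  Vec n = Fin n → Carrier

  _≈ᵥ_ : ∀ {n} → Vec n → Vec n → Set ℓ
  u ≈ᵥ v = ∀ j → u j ≈ v j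

  ∑ : ∀ {m} → (Fin m → Carrier) → Carrier
  ∑ {zero}  f = 0#
  ∑ {suc m} f = f zero + ∑ (λ i → f (suc i))

  lincomb : ∀ {m n} → (Fin m → Carrier) → (Fin m → Vec n) → Vec n
  lincomb cs w j = ∑ (λ a → cs a * w a j)

  LinIndep : ∀ {m n} → (Fin m → Vec n) → Set (c ⊔ ℓ)
  LinIndep {m} {n} w = ∀ (cs : Fin m → Carrier) → lincomb cs w ≈ᵥ (λ _ → 0#) → ∀ a → cs a ≈ 0#

  -- an [n,k]-code, given by a generator matrix (k linearly independent rows in F^n)
  record Code (n k : ℕ) : Set (c ⊔ ℓ) where
    field
      gen   : Fin k → Vec n
      indep : LinIndep gen

  open Code public

  _∈span_ : ∀ {n k} → Vec n → (Fin k → Vec n) → Set (c ⊔ ℓ)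
  v ∈span G = ∃[ cs ] (v ≈ᵥ lincomb cs G)

  _∈C_ : ∀ {n k} → Vec n → Code n k → Set (c ⊔ ℓ)
  v ∈C X = v ∈span gen X

  SameCode : ∀ {n k} → Code n k → Code n k → Set (c ⊔ ℓ)
  SameCode X Y = ∀ v → (v ∈C X → v ∈C Y) × (v ∈C Y → v ∈C X)

  DimCapAtLeast : ∀ {n k} → ℕ → Code n k → Code n k → Set (c ⊔ ℓ)
  DimCapAtLeast {n} m X Y =
    ∃[ w ] ((∀ (a : Fin m) → (w a ∈C X) × (w a ∈C Y)) × LinIndep {m} {n} w)

  DimCapIsPred : ∀ {n k} → Code n k → Code n k → Set (c ⊔ ℓ)
  DimCapIsPred {k = k} X Y = DimCapAtLeast (k ∸ 1) X Y × ¬ DimCapAtLeast k X Y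

  InCt : ∀ {n k} → ℕ → Code n k → Set (c ⊔ ℓ)
  InCt {n} {k} t X =
    ∀ (s : Fin t → Fin n) → Injective _≡_ _≡_ s →
      LinIndep {t} {k} (λ a i → gen X i (s a))

  record Vertex (t n k : ℕ) : Set (c ⊔ ℓ) where
    field
      code : Code n k
      inCt : InCt t code

  open Vertex public

  Adj : ∀ {t n k} → Vertex t n k → Vertex t n k → Set (c ⊔ ℓ)
  Adj X Y = DimCapIsPred (code X) (code Y)

  Connected : ∀ {t n k} → Vertex t n k → Vertex t n k → Set (c ⊔ ℓ)
  Connected = Star Adj

  record Monomial (n : ℕ) : Set (c ⊔ ℓ) where
    field
      perm    : Permutation′ n
      scal    : Fin n → Carrier
      scal≉0  : ∀ i → ¬ (scal i ≈ 0#)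

  applyM : ∀ {n} → Monomial n → Vec n → Vec n
  applyM g v i = Monomial.scal g i * v (Monomial.perm g ⟨$⟩ʳ i)

  actRows : ∀ {n k} → Monomial n → Code n k → Fin k → Vec n
  actRows g X i = applyM g (gen X i)

  IsImage : ∀ {n k} → Monomial n → Code n k → Code n k → Set (c ⊔ ℓ)
  IsImage g X Y = ∀ v → (v ∈C Y → v ∈span actRows g X) × (v ∈span actRows g X → v ∈C Y)

-- The monomial group is generated by transpositions of two coordinates and by
-- rescalings of a single coordinate, so it suffices to pass from a code X to h·X
-- for one such generator h while staying in the component.  For every such h the
-- generator matrices A and hA of X and h·X agree on the kernel of one linear
-- functional μ on coefficient vectors, so X ∩ h·X contains the image of ker μ,
-- a (k−1)-dimensional subspace: h·X is X itself or adjacent to it.  Monomial maps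
-- preserve 𝒞_t, so h·X is again a vertex.  Finiteness of F is used only to decide
-- span membership, which tells the two cases apart.

module Submission where

open import Level using (_⊔_)
open import Defs

open import Data.Nat as ℕ using (ℕ; zero; suc; _<_; _≤_; _^_; s≤s)
import Data.Nat.Properties as ℕ
open import Data.Fin using (Fin; zero; suc; toℕ; fromℕ<; punchIn; finToFun; funToFin)
open import Data.Fin.Properties using (_≟_; any?; all?; toℕ-fromℕ<; toℕ-injective; toℕ<n; punchInᵢ≢i; finToFun-funToFin)
open import Data.Fin.Permutation using (Permutation′; _⟨$⟩ʳ_; _⟨$⟩ˡ_; _∘ₚ_; transpose; inverseʳ)
import Data.Fin.Permutation as Perm
import Data.Fin.Permutation.Components as PC
open import Data.Product using (∃-syntax; _×_; _,_; proj₁; proj₂)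
open import Relation.Binary.Construct.Closure.ReflexiveTransitive using (ε; _◅_; _◅◅_)
open import Function using (_∘_; id)
open import Function.Bundles using (Injection)
open import Function.Properties.Inverse using (↔⇒↣)
open import Relation.Nullary using (¬_; Dec; yes; no; ¬?; contradiction)
open import Relation.Nullary.Decidable using (decidable-stable; map′)
open import Relation.Binary using (Decidable)
open import Data.Vec.Functional using (_∷_; insertAt)
open import Data.Vec.Functional.Properties using (insertAt-lookup; insertAt-punchIn)
open import Relation.Binary.PropositionalEquality as ≡ using (_≡_; _≢_)

transpose-matchˡ : ∀ {n} (i j : Fin n) → PC.transpose i j i ≡ j
transpose-matchˡ i j with i ≟ i
... | yes _ = ≡.refl
... | no i≢i = contradiction ≡.refl i≢i

transpose-fixes : ∀ {n} {i j k : Fin n} → k ≢ i → k ≢ j → PC.transpose i j k ≡ k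
transpose-fixes {i = i} {j} {k} k≢i k≢j with k ≟ i
... | yes k≡i = contradiction k≡i k≢i
... | no _ with k ≟ j
...   | yes k≡j = contradiction k≡j k≢j
...   | no _ = ≡.refl

transpositions-generate :
  ∀ {n p} (P : Permutation′ n → Set p) →
  (∀ {π ρ} → π Perm.≈ ρ → P π → P ρ) → P Perm.id →
  (∀ {π} i j → P π → P (transpose i j ∘ₚ π)) →
  ∀ σ → P σ
transpositions-generate {n} P P-resp P-id P-transpose σ =
  let π , Pπ , π≈σ = agreeing-prefix n ℕ.≤-refl in P-resp (λ j → π≈σ j (toℕ<n j)) Pπ
  where
  agreeing-prefix : ∀ m → m ≤ n → ∃[ π ] (P π × (∀ j → toℕ j < m → π ⟨$⟩ʳ j ≡ σ ⟨$⟩ʳ j))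
  agreeing-prefix zero _ = Perm.id , P-id , λ _ ()
  agreeing-prefix (suc m) m<n with agreeing-prefix m (ℕ.<⇒≤ m<n)
  ... | π , Pπ , π≈σ = transpose i x ∘ₚ π , P-transpose i x Pπ , agrees
    where
    i = fromℕ< m<n
    x = π ⟨$⟩ˡ (σ ⟨$⟩ʳ i)

    agrees : ∀ j → toℕ j < suc m → π ⟨$⟩ʳ PC.transpose i x j ≡ σ ⟨$⟩ʳ j
    agrees j j<1+m with toℕ j ℕ.≟ m
    ... | yes j≡m with toℕ-injective (≡.trans j≡m (≡.sym (toℕ-fromℕ< m<n)))
    ...   | ≡.refl = ≡.trans (≡.cong (π ⟨$⟩ʳ_) (transpose-matchˡ i x)) (inverseʳ π)
    agrees j j<1+m | no j≢m = ≡.trans (≡.cong (π ⟨$⟩ʳ_) (transpose-fixes j≢i j≢x)) (π≈σ j j<m)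
      where
      j<m = ℕ.≤∧≢⇒< (ℕ.≤-pred j<1+m) j≢m
      j≢i : j ≢ i
      j≢i j≡i = j≢m (≡.trans (≡.cong toℕ j≡i) (toℕ-fromℕ< m<n))
      -- π j = σ j, while π x = σ i
      j≢x : j ≢ x
      j≢x j≡x = j≢i (Injection.injective (↔⇒↣ σ)
        (≡.trans (≡.sym (π≈σ j j<m)) (≡.trans (≡.cong (π ⟨$⟩ʳ_) j≡x) (inverseʳ π))))

module LinearAlgebra {c ℓ} (F : Field c ℓ) where
  open Field F hiding (zero)
  open Codes F
  open import Algebra.Properties.Ring ring
    using (-1*x≈-x; -‿distribˡ-*; -‿distribʳ-*; +-inverseˡ-unique)
  open import Algebra.Properties.Semiring.Sum semiring
    using (sum; sum-cong-≋; sum-replicate-zero; sum-remove; ∑-comm; ∑-distrib-+; *-distribˡ-sum)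
  open import Relation.Binary.Reasoning.Setoid setoid

  ∑≈sum : ∀ {m} (f : Fin m → Carrier) → ∑ f ≈ sum f
  ∑≈sum {zero} f = refl
  ∑≈sum {suc m} f = +-congˡ (∑≈sum (f ∘ suc))

  ∑-cong : ∀ {m} {f g : Fin m → Carrier} → (∀ a → f a ≈ g a) → ∑ f ≈ ∑ g
  ∑-cong {f = f} {g} f≈g = trans (∑≈sum f) (trans (sum-cong-≋ f≈g) (sym (∑≈sum g)))

  ∑-zero : ∀ {m} (f : Fin m → Carrier) → (∀ a → f a ≈ 0#) → ∑ f ≈ 0#
  ∑-zero {m} f f≈0 = trans (∑-cong f≈0) (trans (∑≈sum {m} (λ _ → 0#)) (sum-replicate-zero m))

  *-distribˡ-∑ : ∀ {m} x (f : Fin m → Carrier) → x * ∑ f ≈ ∑ (λ a → x * f a)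
  *-distribˡ-∑ x f = trans (*-congˡ (∑≈sum f)) (trans (*-distribˡ-sum x f) (sym (∑≈sum (λ a → x * f a))))

  *-distribʳ-∑ : ∀ {m} x (f : Fin m → Carrier) → ∑ f * x ≈ ∑ (λ a → f a * x)
  *-distribʳ-∑ x f = trans (*-comm _ x) (trans (*-distribˡ-∑ x f) (∑-cong (λ a → *-comm x (f a))))

  ∑-remove : ∀ {m} (i : Fin (suc m)) (f : Fin (suc m) → Carrier) → ∑ f ≈ f i + ∑ (f ∘ punchIn i)
  ∑-remove i f = trans (∑≈sum f) (trans (sum-remove f) (+-congˡ (sym (∑≈sum (f ∘ punchIn i)))))

  ∑-swap : ∀ {m k} (f : Fin m → Fin k → Carrier) → ∑ (λ a → ∑ (f a)) ≈ ∑ (λ b → ∑ (λ a → f a b))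
  ∑-swap f = begin
    ∑ (λ a → ∑ (f a))             ≈⟨ ∑-cong (λ a → ∑≈sum (f a)) ⟩
    ∑ (λ a → sum (f a))           ≈⟨ ∑≈sum (λ a → sum (f a)) ⟩
    sum (λ a → sum (f a))         ≈⟨ ∑-comm f ⟩
    sum (λ b → sum (λ a → f a b)) ≈⟨ ∑≈sum (λ b → sum (λ a → f a b)) ⟨
    ∑ (λ b → sum (λ a → f a b))   ≈⟨ ∑-cong (λ b → ∑≈sum (λ a → f a b)) ⟨
    ∑ (λ b → ∑ (λ a → f a b))     ∎

  ∑-distrib-- : ∀ {m} (f g : Fin m → Carrier) → ∑ (λ a → f a - g a) ≈ ∑ f - ∑ g
  ∑-distrib-- f g = begin
    ∑ (λ a → f a - g a)         ≈⟨ ∑≈sum (λ a → f a - g a) ⟩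
    sum (λ a → f a - g a)       ≈⟨ ∑-distrib-+ f (λ a → - g a) ⟩
    sum f + sum (λ a → - g a)   ≈⟨ +-cong (∑≈sum f) (sum-cong-≋ (λ a → -1*x≈-x (g a))) ⟨
    ∑ f + sum (λ a → - 1# * g a) ≈⟨ +-congˡ (*-distribˡ-sum (- 1#) g) ⟨
    ∑ f + - 1# * sum g           ≈⟨ +-congˡ (trans (-1*x≈-x _) (-‿cong (sym (∑≈sum g)))) ⟩
    ∑ f - ∑ g                    ∎

  δ : ∀ {m} → Fin m → Fin m → Carrier
  δ i j with i ≟ j
  ... | yes _ = 1#
  ... | no _ = 0#

  δ-diag : ∀ {m} (i : Fin m) → δ i i ≈ 1#
  δ-diag i with i ≟ i
  ... | yes _ = refl
  ... | no i≢i = contradiction ≡.refl i≢i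

  δ-offdiag : ∀ {m} {i j : Fin m} → i ≢ j → δ i j ≈ 0#
  δ-offdiag {i = i} {j} i≢j with i ≟ j
  ... | yes i≡j = contradiction i≡j i≢j
  ... | no _ = refl

  δ-sym : ∀ {m} (i j : Fin m) → δ i j ≈ δ j i
  δ-sym i j with i ≟ j
  ... | yes ≡.refl = sym (δ-diag i)
  ... | no i≢j = sym (δ-offdiag (i≢j ∘ ≡.sym))

  ∑-δ : ∀ {m} (i : Fin m) (f : Fin m → Carrier) → ∑ (λ j → δ i j * f j) ≈ f i
  ∑-δ {suc m} i f = begin
    ∑ (λ j → δ i j * f j)                                      ≈⟨ ∑-remove i (λ j → δ i j * f j) ⟩
    δ i i * f i + ∑ (λ j → δ i (punchIn i j) * f (punchIn i j))
      ≈⟨ +-cong (*-congʳ (δ-diag i)) (∑-zero _ off-diagonal) ⟩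
    1# * f i + 0#                                               ≈⟨ trans (+-identityʳ _) (*-identityˡ _) ⟩
    f i                                                         ∎
    where
    off-diagonal : ∀ j → δ i (punchIn i j) * f (punchIn i j) ≈ 0#
    off-diagonal j = trans (*-congʳ (δ-offdiag (punchInᵢ≢i i j ∘ ≡.sym))) (zeroˡ _)

  lincomb-cong : ∀ {m n} {cs ds : Fin m → Carrier} {G H : Fin m → Vec n} →
    (∀ a → cs a ≈ ds a) → (∀ a → G a ≈ᵥ H a) → lincomb cs G ≈ᵥ lincomb ds H
  lincomb-cong cs≈ds G≈H j = ∑-cong (λ a → *-cong (cs≈ds a) (G≈H a j))

  lincomb-assoc : ∀ {m k n} (cs : Fin m → Carrier) (D : Fin m → Fin k → Carrier) (G : Fin k → Vec n) →
    lincomb cs (λ a → lincomb (D a) G) ≈ᵥ lincomb (lincomb cs D) G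
  lincomb-assoc cs D G j = begin
    ∑ (λ a → cs a * ∑ (λ b → D a b * G b j))
      ≈⟨ ∑-cong (λ a → *-distribˡ-∑ (cs a) (λ b → D a b * G b j)) ⟩
    ∑ (λ a → ∑ (λ b → cs a * (D a b * G b j)))
      ≈⟨ ∑-swap (λ a b → cs a * (D a b * G b j)) ⟩
    ∑ (λ b → ∑ (λ a → cs a * (D a b * G b j)))
      ≈⟨ ∑-cong (λ b → ∑-cong (λ a → *-assoc (cs a) (D a b) (G b j))) ⟨
    ∑ (λ b → ∑ (λ a → cs a * D a b * G b j))
      ≈⟨ ∑-cong (λ b → *-distribʳ-∑ (G b j) (λ a → cs a * D a b)) ⟨
    ∑ (λ b → ∑ (λ a → cs a * D a b) * G b j) ∎

  lincomb-tail : ∀ {m n} (cs : Fin (suc m) → Carrier) (G : Fin (suc m) → Vec n) →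
    cs zero ≈ 0# → lincomb cs G ≈ᵥ lincomb (cs ∘ suc) (G ∘ suc)
  lincomb-tail cs G cs₀≈0 j =
    trans (+-congʳ (trans (*-congʳ cs₀≈0) (zeroˡ _))) (+-identityˡ _)

  ∈span-resp : ∀ {m n} {u v : Vec n} {G : Fin m → Vec n} → u ≈ᵥ v → u ∈span G → v ∈span G
  ∈span-resp u≈v (cs , u≈csG) = cs , λ j → trans (sym (u≈v j)) (u≈csG j)

  ∈span-row : ∀ {m n} (G : Fin m → Vec n) (a : Fin m) → G a ∈span G
  ∈span-row G a = δ a , λ j → sym (∑-δ a (λ b → G b j))

  ∈span-trans : ∀ {m k n} {v : Vec n} {W : Fin m → Vec n} {G : Fin k → Vec n} →
    v ∈span W → (∀ a → W a ∈span G) → v ∈span G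
  ∈span-trans {G = G} (cs , v≈csW) W⊆G =
    lincomb cs (proj₁ ∘ W⊆G) ,
    λ j → trans (v≈csW j)
            (trans (lincomb-cong (λ _ → refl) (proj₂ ∘ W⊆G) j) (lincomb-assoc cs (proj₁ ∘ W⊆G) G j))

  SameSpan : ∀ {m k n} → (Fin m → Vec n) → (Fin k → Vec n) → Set (c ⊔ ℓ)
  SameSpan G H = ∀ v → (v ∈span G → v ∈span H) × (v ∈span H → v ∈span G)

  SameCode-trans : ∀ {n k} {X Y Z : Code n k} → SameCode X Y → SameCode Y Z → SameCode X Z
  SameCode-trans X≅Y Y≅Z v = proj₁ (Y≅Z v) ∘ proj₁ (X≅Y v) , proj₂ (X≅Y v) ∘ proj₂ (Y≅Z v)

  SameSpan-pointwise : ∀ {m n} (G H : Fin m → Vec n) → (∀ a → G a ≈ᵥ H a) → SameSpan G H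
  SameSpan-pointwise G H G≈H v =
    (λ v∈G → ∈span-trans v∈G (λ a → ∈span-resp (λ j → sym (G≈H a j)) (∈span-row H a))) ,
    (λ v∈H → ∈span-trans v∈H (λ a → ∈span-resp (G≈H a) (∈span-row G a)))

  LinIndep-lincomb : ∀ {m k n} {w : Fin k → Vec n} {D : Fin m → Fin k → Carrier} →
    LinIndep w → LinIndep D → LinIndep (λ b → lincomb (D b) w)
  LinIndep-lincomb {w = w} {D} w-indep D-indep cs cs·Dw≈0 =
    D-indep cs (w-indep (lincomb cs D) (λ j → trans (sym (lincomb-assoc cs D w j)) (cs·Dw≈0 j)))

  DimCapAtLeast-respˡ : ∀ {n k m} {X Y Z : Code n k} → SameCode X Y → DimCapAtLeast m Y Z → DimCapAtLeast m X Z
  DimCapAtLeast-respˡ X≅Y (w , w∈Y∩Z , w-indep) =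
    w , (λ b → proj₂ (X≅Y (w b)) (proj₁ (w∈Y∩Z b)) , proj₂ (w∈Y∩Z b)) , w-indep

  1≉0 : ¬ 1# ≈ 0#
  1≉0 1≈0 = 0≉1 (sym 1≈0)

  x*y≈0⇒x≈0 : ∀ {x y} → ¬ y ≈ 0# → x * y ≈ 0# → x ≈ 0#
  x*y≈0⇒x≈0 {x} {y} y≉0 xy≈0 = begin
    x                ≈⟨ *-identityʳ x ⟨
    x * 1#           ≈⟨ *-congˡ (proj₂ (inverse y y≉0)) ⟨
    x * (y * y⁻¹)    ≈⟨ *-assoc x y y⁻¹ ⟨
    x * y * y⁻¹      ≈⟨ *-congʳ xy≈0 ⟩
    0# * y⁻¹         ≈⟨ zeroˡ y⁻¹ ⟩
    0#               ∎
    where y⁻¹ = proj₁ (inverse y y≉0)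

  module WithDecidableEquality (_≈?_ : Decidable _≈_) where

    pivot : ∀ {k} (μ : Fin (suc k) → Carrier) →
      ∃[ a₀ ] ∃[ ρ ] (∀ b → μ (punchIn a₀ b) ≈ ρ b * μ a₀)
    pivot μ with any? (λ a → ¬? (μ a ≈? 0#))
    ... | yes (a₀ , μa₀≉0) with inverse (μ a₀) μa₀≉0
    ...   | y , μa₀y≈1 = a₀ , (λ b → μ (punchIn a₀ b) * y) , λ b → begin
      μ (punchIn a₀ b)              ≈⟨ *-identityʳ _ ⟨
      μ (punchIn a₀ b) * 1#         ≈⟨ *-congˡ (trans (*-comm _ _) μa₀y≈1) ⟨
      μ (punchIn a₀ b) * (y * μ a₀) ≈⟨ *-assoc _ y (μ a₀) ⟨
      μ (punchIn a₀ b) * y * μ a₀   ∎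
    pivot μ | no ∄a→μa≉0 = zero , (λ _ → 0#) , λ b → trans (μ≈0 (suc b)) (sym (zeroˡ (μ zero)))
      where
      μ≈0 : ∀ a → μ a ≈ 0#
      μ≈0 a = decidable-stable (μ a ≈? 0#) (λ μa≉0 → ∄a→μa≉0 (a , μa≉0))

    hyperplane-basis : ∀ {k} (μ : Fin (suc k) → Carrier) →
      ∃[ D ] (LinIndep {k} {suc k} D × ∀ b → ∑ (λ a → D b a * μ a) ≈ 0#)
    hyperplane-basis {k} μ with pivot μ
    ... | a₀ , ρ , μ≈ρμa₀ = D , D-indep , D⊥μ
      where
      -- row b is e_(punchIn a₀ b) − ρ b · e_a₀
      D : Fin k → Fin (suc k) → Carrier
      D b = insertAt (δ b) a₀ (- ρ b)

      D-indep : LinIndep D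
      D-indep cs cs·D≈0 b₀ = begin
        cs b₀
          ≈⟨ ∑-δ b₀ cs ⟨
        ∑ (λ b → δ b₀ b * cs b)
          ≈⟨ ∑-cong (λ b → trans (*-comm _ _) (*-congˡ (δ-sym b₀ b))) ⟩
        ∑ (λ b → cs b * δ b b₀)
          ≈⟨ ∑-cong (λ b → *-congˡ (reflexive (insertAt-punchIn (δ b) a₀ (- ρ b) b₀))) ⟨
        ∑ (λ b → cs b * D b (punchIn a₀ b₀))
          ≈⟨ cs·D≈0 (punchIn a₀ b₀) ⟩
        0# ∎

      D⊥μ : ∀ b → ∑ (λ a → D b a * μ a) ≈ 0#
      D⊥μ b = begin
        ∑ (λ a → D b a * μ a)
          ≈⟨ ∑-remove a₀ (λ a → D b a * μ a) ⟩
        D b a₀ * μ a₀ + ∑ (λ c → D b (punchIn a₀ c) * μ (punchIn a₀ c))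
          ≈⟨ +-cong (*-congʳ (reflexive (insertAt-lookup (δ b) a₀ (- ρ b))))
                    (∑-cong (λ c → *-congʳ (reflexive (insertAt-punchIn (δ b) a₀ (- ρ b) c)))) ⟩
        - ρ b * μ a₀ + ∑ (λ c → δ b c * μ (punchIn a₀ c))
          ≈⟨ +-congˡ (∑-δ b (μ ∘ punchIn a₀)) ⟩
        - ρ b * μ a₀ + μ (punchIn a₀ b)
          ≈⟨ +-cong (-‿distribˡ-* (ρ b) (μ a₀)) (sym (μ≈ρμa₀ b)) ⟨
        - (ρ b * μ a₀) + ρ b * μ a₀
          ≈⟨ -‿inverseˡ _ ⟩
        0# ∎

    more-vectors-dependent : ∀ {k m n} (G : Fin k → Vec n) (w : Fin m → Vec n) →
      k < m → (∀ a → w a ∈span G) → ¬ LinIndep w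
    more-vectors-dependent {zero} {suc m} G w _ w⊆G w-indep =
      0≉1 (sym (w-indep (λ _ → 1#) sum≈0 zero))
      where
      sum≈0 : lincomb (λ _ → 1#) w ≈ᵥ (λ _ → 0#)
      sum≈0 j = ∑-zero _ (λ a → trans (*-identityˡ _) (proj₂ (w⊆G a) j))
    more-vectors-dependent {suc k} {suc m} {n} G w (s≤s k<m) w⊆G w-indep
      with hyperplane-basis (λ a → proj₁ (w⊆G a) zero)
    ... | D , D-indep , D⊥ =
      more-vectors-dependent (G ∘ suc) w′ k<m w′⊆G (LinIndep-lincomb {w = w} {D = D} w-indep D-indep)
      where
      C : Fin (suc m) → Fin (suc k) → Carrier
      C = proj₁ ∘ w⊆G
      -- combinations of w in which the first generator G zero cancels out
      w′ : Fin m → Vec n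
      w′ b = lincomb (D b) w

      w′⊆G : ∀ b → w′ b ∈span (G ∘ suc)
      w′⊆G b = lincomb (D b) C ∘ suc , λ j → begin
        lincomb (D b) w j                           ≈⟨ lincomb-cong {cs = D b} (λ _ → refl) (proj₂ ∘ w⊆G) j ⟩
        lincomb (D b) (λ a → lincomb (C a) G) j     ≈⟨ lincomb-assoc (D b) C G j ⟩
        lincomb (lincomb (D b) C) G j               ≈⟨ lincomb-tail (lincomb (D b) C) G (D⊥ b) j ⟩
        lincomb (lincomb (D b) C ∘ suc) (G ∘ suc) j ∎

    LinIndep-∷ : ∀ {k n} {v : Vec n} {W : Fin k → Vec n} →
      LinIndep W → ¬ v ∈span W → LinIndep (v ∷ W)
    LinIndep-∷ {v = v} {W} W-indep v∉W cs cs·vW≈0 with cs zero ≈? 0#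
    ... | yes cs₀≈0 = λ { zero → cs₀≈0 ; (suc a) → W-indep (cs ∘ suc) tail≈0 a }
      where
      tail≈0 : lincomb (cs ∘ suc) W ≈ᵥ (λ _ → 0#)
      tail≈0 j = trans (sym (lincomb-tail cs (v ∷ W) cs₀≈0 j)) (cs·vW≈0 j)
    ... | no cs₀≉0 with inverse (cs zero) cs₀≉0
    ...   | y , cs₀y≈1 = contradiction v∈W v∉W
      where
      L : Vec _
      L = lincomb (cs ∘ suc) W
      v∈W : v ∈span W
      v∈W = (λ a → - y * cs (suc a)) , λ j → begin
        v j                                  ≈⟨ *-identityˡ _ ⟨
        1# * v j                             ≈⟨ *-congʳ (trans (*-comm _ _) cs₀y≈1) ⟨
        y * cs zero * v j                    ≈⟨ *-assoc _ _ _ ⟩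
        y * (cs zero * v j)                  ≈⟨ *-congˡ (+-inverseˡ-unique _ _ (cs·vW≈0 j)) ⟩
        y * - L j                            ≈⟨ trans (sym (-‿distribˡ-* y (L j))) (-‿distribʳ-* y (L j)) ⟨
        - y * L j                            ≈⟨ *-distribˡ-∑ (- y) (λ a → cs (suc a) * W a j) ⟩
        ∑ (λ a → - y * (cs (suc a) * W a j)) ≈⟨ ∑-cong (λ a → *-assoc (- y) (cs (suc a)) (W a j)) ⟨
        ∑ (λ a → - y * cs (suc a) * W a j)   ∎

module FiniteField {c ℓ} (F : Field c ℓ) {q : ℕ} (HO : HasOrder F q) where
  open Field F hiding (zero)
  open Codes F
  open HasOrder HO
  open LinearAlgebra F

  infix 4 _≈?_ _∈span?_

  _≈?_ : Decidable _≈_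
  x ≈? y with enum-surj x | enum-surj y
  ... | i , eᵢ≈x | j , eⱼ≈y with i ≟ j
  ...   | yes ≡.refl = yes (trans (sym eᵢ≈x) eⱼ≈y)
  ...   | no i≢j = no (λ x≈y → i≢j (enum-inj i j (trans eᵢ≈x (trans x≈y (sym eⱼ≈y)))))

  open WithDecidableEquality _≈?_ public

  -- coefficient vectors range over the q ^ k enumerated tuples
  _∈span?_ : ∀ {k n} (v : Vec n) (G : Fin k → Vec n) → Dec (v ∈span G)
  _∈span?_ {k} v G =
    map′ (λ (i , v≈) → enum ∘ finToFun i , v≈) from-coefficients
      (any? λ (i : Fin (q ^ k)) → all? λ j → v j ≈? lincomb (enum ∘ finToFun i) G j)
    where
    from-coefficients : v ∈span G → ∃[ i ] (v ≈ᵥ lincomb (enum ∘ finToFun i) G)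
    from-coefficients (cs , v≈csG) =
      funToFin index , λ j → trans (v≈csG j) (lincomb-cong {G = G} cs≈ (λ _ _ → refl) j)
      where
      index = λ a → proj₁ (enum-surj (cs a))
      cs≈ : ∀ a → cs a ≈ enum (finToFun (funToFin index) a)
      cs≈ a = trans (sym (proj₂ (enum-surj (cs a)))) (reflexive (≡.cong enum (≡.sym (finToFun-funToFin index a))))

  independent⊆⇒SameSpan : ∀ {k n} (G W : Fin k → Vec n) →
    LinIndep W → (∀ a → W a ∈span G) → SameSpan G W
  independent⊆⇒SameSpan {k} G W W-indep W⊆G v = G⊆W , λ v∈W → ∈span-trans v∈W W⊆G
    where
    G⊆W : v ∈span G → v ∈span W
    G⊆W v∈G with v ∈span? W
    ... | yes v∈W = v∈W
    ... | no v∉W = contradiction (LinIndep-∷ W-indep v∉W)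
                     (more-vectors-dependent G (v ∷ W) (ℕ.n<1+n k) λ { zero → v∈G ; (suc a) → W⊆G a })

  DimCapAtLeast-full⇒⊇ : ∀ {n k} {X Y : Code n k} → DimCapAtLeast k X Y → ∀ v → v ∈C Y → v ∈C X
  DimCapAtLeast-full⇒⊇ {Y = Y} (w , w∈X∩Y , w-indep) v v∈Y =
    ∈span-trans (proj₁ (independent⊆⇒SameSpan (gen Y) w w-indep (proj₂ ∘ w∈X∩Y) v) v∈Y) (proj₁ ∘ w∈X∩Y)

module Monomials {c ℓ} (F : Field c ℓ) where
  open Field F hiding (zero)
  open Codes F
  open LinearAlgebra F
  open Monomial
  open import Algebra.Properties.CommutativeSemigroup *-commutativeSemigroup using (x∙yz≈y∙xz)
  open import Relation.Binary.Reasoning.Setoid setoid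

  permMonomial : ∀ {n} → Permutation′ n → Monomial n
  permMonomial π = record { perm = π ; scal = λ _ → 1# ; scal≉0 = λ _ → 1≉0 }

  infix 4 _≃_
  _≃_ : ∀ {n} → Monomial n → Monomial n → Set (c ⊔ ℓ)
  M ≃ M′ = ∀ v → applyM M v ≈ᵥ applyM M′ v

  applyM-lincomb : ∀ {m n} (M : Monomial n) (cs : Fin m → Carrier) (G : Fin m → Vec n) →
    applyM M (lincomb cs G) ≈ᵥ lincomb cs (λ a → applyM M (G a))
  applyM-lincomb M cs G i = begin
    scal M i * ∑ (λ a → cs a * G a σi)   ≈⟨ *-distribˡ-∑ (scal M i) (λ a → cs a * G a σi) ⟩
    ∑ (λ a → scal M i * (cs a * G a σi)) ≈⟨ ∑-cong (λ a → x∙yz≈y∙xz (scal M i) (cs a) (G a σi)) ⟩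
    ∑ (λ a → cs a * (scal M i * G a σi)) ∎
    where
    σi = perm M ⟨$⟩ʳ i

  applyM-reflects-0 : ∀ {n} (M : Monomial n) {v : Vec n} → applyM M v ≈ᵥ (λ _ → 0#) → v ≈ᵥ (λ _ → 0#)
  applyM-reflects-0 M {v} Mv≈0 j =
    ≡.subst (λ i → v i ≈ 0#) (inverseʳ (perm M))
      (x*y≈0⇒x≈0 (scal≉0 M i) (trans (*-comm _ _) (Mv≈0 i)))
    where
    i = perm M ⟨$⟩ˡ j

  LinIndep-applyM : ∀ {m n} (M : Monomial n) {G : Fin m → Vec n} →
    LinIndep G → LinIndep (λ a → applyM M (G a))
  LinIndep-applyM M {G} G-indep cs cs·MG≈0 =
    G-indep cs (applyM-reflects-0 M (λ i → trans (applyM-lincomb M cs G i) (cs·MG≈0 i)))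

  infixr 6 _·_
  _·_ : ∀ {n k} → Monomial n → Code n k → Code n k
  M · X = record { gen = actRows M X ; indep = LinIndep-applyM M (indep X) }

  -- column s of M · X is column σ s of X scaled by a nonzero factor
  InCt-· : ∀ {t n k} (M : Monomial n) {X : Code n k} → InCt t X → InCt t (M · X)
  InCt-· M {X} X∈Ct s s-inj cs cs·cols≈0 a =
    x*y≈0⇒x≈0 (scal≉0 M (s a))
      (X∈Ct (λ a → perm M ⟨$⟩ʳ s a) (s-inj ∘ Injection.injective (↔⇒↣ (perm M)))
            (λ a → cs a * scal M (s a)) scaled≈0 a)
    where
    scaled≈0 : lincomb (λ a → cs a * scal M (s a)) (λ a i → gen X i (perm M ⟨$⟩ʳ s a)) ≈ᵥ (λ _ → 0#)
    scaled≈0 i = trans (∑-cong (λ a → *-assoc (cs a) _ _)) (cs·cols≈0 i)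

  module Generation {n p} (P : Monomial n → Set p)
    (P-resp : ∀ M M′ → M ≃ M′ → P M → P M′)
    (P-swap : ∀ M M′ i j → (∀ v k → applyM M′ v k ≈ applyM M v (PC.transpose i j k)) → P M → P M′)
    (P-scale : ∀ M M′ i x → (∀ v k → k ≢ i → applyM M′ v k ≈ applyM M v k) →
               (∀ v → applyM M′ v i ≈ x * applyM M v i) → P M → P M′)
    (P-id : P (permMonomial Perm.id))
    where

    P-permMonomial : ∀ σ → P (permMonomial σ)
    P-permMonomial = transpositions-generate (P ∘ permMonomial)
      (λ {π} {ρ} π≈ρ → P-resp (permMonomial π) (permMonomial ρ)
                          (λ v j → *-congˡ (reflexive (≡.cong v (π≈ρ j)))))
      P-id
      (λ {π} i j → P-swap (permMonomial π) (permMonomial (transpose i j ∘ₚ π)) i j (λ _ _ → refl))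

    module _ (g : Monomial n) where
      prefixScal : ℕ → Fin n → Carrier
      prefixScal m j with toℕ j ℕ.<? m
      ... | yes _ = scal g j
      ... | no _ = 1#

      prefixScal-below : ∀ {m j} → toℕ j < m → prefixScal m j ≡ scal g j
      prefixScal-below {m} {j} j<m with toℕ j ℕ.<? m
      ... | yes _ = ≡.refl
      ... | no j≮m = contradiction j<m j≮m

      prefixScal-above : ∀ {m j} → ¬ toℕ j < m → prefixScal m j ≡ 1#
      prefixScal-above {m} {j} j≮m with toℕ j ℕ.<? m
      ... | yes j<m = contradiction j<m j≮m
      ... | no _ = ≡.refl

      prefixScal≉0 : ∀ m j → ¬ prefixScal m j ≈ 0#
      prefixScal≉0 m j with toℕ j ℕ.<? m
      ... | yes _ = scal≉0 g j
      ... | no _ = 1≉0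

      prefixMonomial : ℕ → Monomial n
      prefixMonomial m = record { perm = perm g ; scal = prefixScal m ; scal≉0 = prefixScal≉0 m }

      P-prefixMonomial : ∀ m → m ≤ n → P (prefixMonomial m)
      P-prefixMonomial zero _ = P-resp (permMonomial (perm g)) (prefixMonomial 0)
        (λ v j → *-congʳ (reflexive (≡.sym (prefixScal-above {0} {j} λ ())))) (P-permMonomial (perm g))
      P-prefixMonomial (suc m) m<n = P-scale (prefixMonomial m) (prefixMonomial (suc m)) i (scal g i)
        unchanged rescaled (P-prefixMonomial m (ℕ.<⇒≤ m<n))
        where
        i = fromℕ< m<n
        toℕi≡m = toℕ-fromℕ< m<n

        unchanged : ∀ v j → j ≢ i → applyM (prefixMonomial (suc m)) v j ≈ applyM (prefixMonomial m) v j
        unchanged v j j≢i = *-congʳ (reflexive (same-scalar (toℕ j ℕ.<? m)))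
          where
          same-scalar : Dec (toℕ j < m) → prefixScal (suc m) j ≡ prefixScal m j
          same-scalar (yes j<m) = ≡.trans (prefixScal-below (ℕ.m<n⇒m<1+n j<m)) (≡.sym (prefixScal-below j<m))
          same-scalar (no j≮m) = ≡.trans (prefixScal-above j≮1+m) (≡.sym (prefixScal-above j≮m))
            where
            j≮1+m : ¬ toℕ j < suc m
            j≮1+m j<1+m = j≢i (toℕ-injective
              (≡.trans (ℕ.≤-antisym (ℕ.≤-pred j<1+m) (ℕ.≮⇒≥ j≮m)) (≡.sym toℕi≡m)))

        rescaled : ∀ v → applyM (prefixMonomial (suc m)) v i ≈ scal g i * applyM (prefixMonomial m) v i
        rescaled v = begin
          prefixScal (suc m) i * v σi
            ≈⟨ *-congʳ (reflexive (prefixScal-below (≡.subst (_< suc m) (≡.sym toℕi≡m) (ℕ.n<1+n m)))) ⟩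
          scal g i * v σi
            ≈⟨ *-congˡ (*-identityˡ _) ⟨
          scal g i * (1# * v σi)
            ≈⟨ *-congˡ (*-congʳ (reflexive (prefixScal-above (ℕ.<-irrefl toℕi≡m)))) ⟨
          scal g i * (prefixScal m i * v σi) ∎
          where
          σi = perm g ⟨$⟩ʳ i

    all-monomials : ∀ g → P g
    all-monomials g = P-resp (prefixMonomial g n) g
      (λ v j → *-congʳ (reflexive (prefixScal-below g (toℕ<n j)))) (P-prefixMonomial g n ℕ.≤-refl)

module CodeGraph {c ℓ} (F : Field c ℓ) {q : ℕ} (HO : HasOrder F q) where
  open Field F hiding (zero)
  open Codes F
  open LinearAlgebra F
  open FiniteField F HO
  open Monomials F
  open import Algebra.Properties.Ring ring using (x[y-z]≈xy-xz; x∙y⁻¹≈ε⇒x≈y)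
  open import Relation.Binary.Reasoning.Setoid setoid

  module ComponentOf {t n k : ℕ} (C : Vertex t n (suc k)) where

    Reachable : Code n (suc k) → Set (c ⊔ ℓ)
    Reachable X = ∃[ D ] (SameCode (code D) X × Connected C D)

    ReachableImage : Monomial n → Set (c ⊔ ℓ)
    ReachableImage M = Reachable (M · code C)

    AgreeOnKernel : ∀ {m} → (Fin m → Carrier) → (Fin m → Vec n) → (Fin m → Vec n) → Set (c ⊔ ℓ)
    AgreeOnKernel μ A A′ = ∀ d → ∑ (λ a → d a * μ a) ≈ 0# → lincomb d A ≈ᵥ lincomb d A′

    AgreeOnKernel⇒DimCapAtLeast : ∀ {μ} {X Y : Code n (suc k)} →
      AgreeOnKernel μ (gen X) (gen Y) → DimCapAtLeast k X Y
    AgreeOnKernel⇒DimCapAtLeast {μ} {X} agree with hyperplane-basis μ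
    ... | D , D-indep , D⊥μ =
      (λ b → lincomb (D b) (gen X)) ,
      (λ b → (D b , λ _ → refl) , (D b , agree (D b) (D⊥μ b))) ,
      LinIndep-lincomb {w = gen X} {D = D} (indep X) D-indep

    -- X′ contains the k-dimensional image of ker μ in X, so X′ is X itself or a neighbour of it
    reachable-step : ∀ (X X′ : Code n (suc k)) → InCt t X′ → (μ : Fin (suc k) → Carrier) →
      AgreeOnKernel μ (gen X) (gen X′) → Reachable X → Reachable X′
    reachable-step X X′ X′∈Ct μ agree (D , D≅X , C⇝D) with all? (λ b → gen X′ b ∈span? gen (code D))
    ... | yes X′⊆D = D , independent⊆⇒SameSpan (gen (code D)) (gen X′) (indep X′) X′⊆D , C⇝D
    ... | no X′⊈D = Y , (λ _ → id , id) , C⇝D ◅◅ (D∼Y ◅ ε)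
      where
      Y : Vertex t n (suc k)
      Y = record { code = X′ ; inCt = X′∈Ct }

      D∼Y : Adj D Y
      D∼Y = DimCapAtLeast-respˡ {X = code D} {X} {X′} D≅X (AgreeOnKernel⇒DimCapAtLeast {μ} {X} {X′} agree) ,
            λ D∩X′-full → X′⊈D λ b →
              DimCapAtLeast-full⇒⊇ {X = code D} {X′} D∩X′-full (gen X′ b) (∈span-row (gen X′) b)

    G : Fin (suc k) → Vec n
    G = gen (code C)

    agreeOnKernel-applyM : ∀ {M M′ μ} →
      (∀ d → ∑ (λ a → d a * μ a) ≈ 0# → applyM M (lincomb d G) ≈ᵥ applyM M′ (lincomb d G)) →
      AgreeOnKernel μ (gen (M · code C)) (gen (M′ · code C))
    agreeOnKernel-applyM {M} {M′} agree d d⊥μ j =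
      trans (sym (applyM-lincomb M d G j)) (trans (agree d d⊥μ j) (applyM-lincomb M′ d G j))

    reachable-resp : ∀ M M′ → M ≃ M′ → ReachableImage M → ReachableImage M′
    reachable-resp M M′ M≃M′ (D , D≅MC , C⇝D) =
      D , SameCode-trans {X = code D} {M · code C} {M′ · code C} D≅MC MC≅M′C , C⇝D
      where
      MC≅M′C : SameCode (M · code C) (M′ · code C)
      MC≅M′C = SameSpan-pointwise (gen (M · code C)) (gen (M′ · code C)) (M≃M′ ∘ G)

    ≈-transpose : ∀ (f : Fin n → Carrier) {i i′} → f i ≈ f i′ → ∀ j → f j ≈ f (PC.transpose i i′ j)
    ≈-transpose f {i} {i′} fi≈fi′ j with j ≟ i
    ... | yes ≡.refl = fi≈fi′
    ... | no _ with j ≟ i′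
    ...   | yes ≡.refl = sym fi≈fi′
    ...   | no _ = refl

    reachable-swap : ∀ M M′ i i′ → (∀ v j → applyM M′ v j ≈ applyM M v (PC.transpose i i′ j)) →
      ReachableImage M → ReachableImage M′
    reachable-swap M M′ i i′ M′≈M∘τ =
      reachable-step (M · code C) (M′ · code C) (InCt-· M′ {code C} (inCt C)) μ
        (agreeOnKernel-applyM {M} {M′} {μ} agree)
      where
      μ = λ a → applyM M (G a) i - applyM M (G a) i′

      agree : ∀ d → ∑ (λ a → d a * μ a) ≈ 0# → applyM M (lincomb d G) ≈ᵥ applyM M′ (lincomb d G)
      agree d d⊥μ j =
        trans (≈-transpose (applyM M u) (x∙y⁻¹≈ε⇒x≈y (applyM M u i) (applyM M u i′) Mu-difference≈0) j)
              (sym (M′≈M∘τ u j))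
        where
        u = lincomb d G
        Mu-difference≈0 : applyM M u i - applyM M u i′ ≈ 0#
        Mu-difference≈0 = begin
          applyM M u i - applyM M u i′
            ≈⟨ +-cong (applyM-lincomb M d G i) (-‿cong (applyM-lincomb M d G i′)) ⟩
          lincomb d (gen (M · code C)) i - lincomb d (gen (M · code C)) i′
            ≈⟨ ∑-distrib-- (λ a → d a * applyM M (G a) i) (λ a → d a * applyM M (G a) i′) ⟨
          ∑ (λ a → d a * applyM M (G a) i - d a * applyM M (G a) i′)
            ≈⟨ ∑-cong (λ a → x[y-z]≈xy-xz (d a) (applyM M (G a) i) (applyM M (G a) i′)) ⟨
          ∑ (λ a → d a * μ a)
            ≈⟨ d⊥μ ⟩
          0# ∎

    reachable-scale : ∀ M M′ i x → (∀ v j → j ≢ i → applyM M′ v j ≈ applyM M v j) →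
      (∀ v → applyM M′ v i ≈ x * applyM M v i) → ReachableImage M → ReachableImage M′
    reachable-scale M M′ i x unchanged rescaled =
      reachable-step (M · code C) (M′ · code C) (InCt-· M′ {code C} (inCt C)) μ
        (agreeOnKernel-applyM {M} {M′} {μ} agree)
      where
      μ = λ a → applyM M (G a) i

      agree : ∀ d → ∑ (λ a → d a * μ a) ≈ 0# → applyM M (lincomb d G) ≈ᵥ applyM M′ (lincomb d G)
      agree d d⊥μ j with j ≟ i
      ... | no j≢i = sym (unchanged (lincomb d G) j j≢i)
      ... | yes ≡.refl = begin
        applyM M (lincomb d G) j        ≈⟨ applyM-lincomb M d G j ⟩
        ∑ (λ a → d a * μ a)             ≈⟨ d⊥μ ⟩
        0#                              ≈⟨ zeroʳ x ⟨
        x * 0#                          ≈⟨ *-congˡ (trans (applyM-lincomb M d G j) d⊥μ) ⟨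
        x * applyM M (lincomb d G) j    ≈⟨ rescaled (lincomb d G) ⟨
        applyM M′ (lincomb d G) j       ∎

    reachable-id : ReachableImage (permMonomial Perm.id)
    reachable-id = C , SameSpan-pointwise G (gen (permMonomial Perm.id · code C)) (λ a j → sym (*-identityˡ _)) , ε

theorem2p3 : ∀ {c ℓ} (q : ℕ) → IsPrimePower q → (F : Field c ℓ) → HasOrder F q →
    (n k t : ℕ) → 0 < k → k < n → t ≤ k →
    let open Codes F in
    (C : Vertex t n k) → (g : Monomial n) →
    ∃[ D ] (IsImage g (code C) (code D) × Connected C D)
theorem2p3 q _ F HO n zero t () _ _ C g
theorem2p3 q _ F HO n (suc k) t _ _ _ C g = all-monomials g
  where
  open CodeGraph.ComponentOf F HO C
  open Monomials.Generation F ReachableImage reachable-resp reachable-swap reachable-scale reachable-id
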